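{- Let $\mathfrak{A}$ be a finite family of multi-families of subsets of $X=X_1\uplus\cdots\uplus X_M$ such that the set $\mu(\mathfrak{A}(\mathcal{L}))$ does not depend on the choice of the product-permutation $\mathcal{L}$. Then $$\mu(\mathfrak{A})\subseteq\Big\langle\big\{S(I): I \text{ a multiset on }\pi_M\text{ with } T(I)\in\mu(\mathfrak{A}(\mathcal{L}))\big\}\Big\rangle.$$
   Context: $X$ is a finite set partitioned as $X=X_1\uplus\cdots\uplus X_M$, $|X_i|=m_i\ge1$, $n_i=m_i+1$, $[n]^{\star}=\{0,\ldots,n-1\}$, $\pi_M=\prod_i[n_i]^{\star}$. A multi-family is a multiset of subsets of $X$. Its profile matrix $\mathcal{P}(\mathcal{F})=(p_{i_1,\ldots,i_M})_{\pi_M}$ has $p_{i_1,\ldots,i_M}$ = number of members (with multiplicity) $F$ with $|F\cap X_j|=i_j$ for all $j$; it is viewed as a point of $\mathbb{R}^N$, $N=\prod_j n_j$. For a family $\mathfrak{A}$ of multi-families, $\mu(\mathfrak{A})=\{\mathcal{P}(\mathcal{F}):\mathcal{F}\in\mathfrak{A}\}$; $\langle\cdot\rangle$ denotes convex hull. A product-permutation $\mathcal{L}$ is a choice of a linear ordering of each $X_j$; a set $H\subseteq X$ is initial with respect to $\mathcal{L}$ if for every $j$, $H\cap X_j$ consists of the first $|H\cap X_j|$ elements of $X_j$ in its ordering. For a multi-family $\mathcal{H}$, $\mathcal{H}(\mathcal{L})$ is the multi-family of members of $\mathcal{H}$ initial with respect to $\mathcal{L}$, with their multiplicities in $\mathcal{H}$;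 $\mathfrak{A}(\mathcal{L})=\{\mathcal{H}(\mathcal{L}):\mathcal{H}\in\mathfrak{A}\}$. For a multiset $I$ of elements of $\pi_M$, $T(I)$ is the matrix indexed by $\pi_M$ whose $(i_1,\ldots,i_M)$ entry is the multiplicity of $(i_1,\ldots,i_M)$ in $I$, and $S(I)$ is the matrix with entries $t_{i_1,\ldots,i_M}(I)\prod_{j=1}^M\binom{m_j}{i_j}$. -}

module Defs where

open import Data.Nat using (ℕ; suc; _<ᵇ_)
import Data.Nat as N
open import Data.Nat.Combinatorics using (_C_)
open import Data.Bool using (Bool)
open import Data.Fin using (Fin; toℕ)
import Data.Fin as F
open import Data.Fin.Properties using (all?)
open import Data.Fin.Subset using (Subset; ∣_∣)
open import Data.Fin.Permutation using (Permutation′; _⟨$⟩ʳ_)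
open import Data.Vec using (tabulate)
open import Data.Vec.Properties using (≡-dec)
import Data.Bool.Properties as BP
open import Data.List using (List; []; _∷_; filter; length; map)
open import Data.List.Membership.Propositional using (_∈_)
open import Data.Integer using (+_)
open import Data.Rational using (ℚ; _/_; 0ℚ; 1ℚ; _+_; _*_)
import Data.Rational as Q
open import Data.Product using (Σ; _×_; ∃; _,_; proj₁)
open import Data.List.Relation.Unary.All using (All)
open import Relation.Binary.PropositionalEquality using (_≡_)
open import Relation.Nullary.Decidable using (⌊_⌋; Dec)

-- Ground set X = X_1 ⊎ ... ⊎ X_M with X_j ≅ Fin (m j).
-- A subset H ⊆ X is given by its traces H ∩ X_j, one Subset (m j) per block.

SubsetX : (M : ℕ) → (Fin M → ℕ) → Set
SubsetX M m = (j : Fin M) → Subset (m j)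

-- A multi-family: a multiset of subsets of X, represented as a list
-- (multiplicity = number of occurrences in the list).
MultiFamily : (M : ℕ) → (Fin M → ℕ) → Set
MultiFamily M m = List (SubsetX M m)

FamilyOfMF : (M : ℕ) → (Fin M → ℕ) → Set
FamilyOfMF M m = List (MultiFamily M m)

-- The index set π_M = ∏_j [n_j]^⋆, n_j = m_j + 1.
Index : (M : ℕ) → (Fin M → ℕ) → Set
Index M m = (j : Fin M) → Fin (suc (m j))

Matrix : (M : ℕ) → (Fin M → ℕ) → Set → Set
Matrix M m A = Index M m → A

hasProfile : {M : ℕ} {m : Fin M → ℕ} → Index M m → SubsetX M m → Bool
hasProfile i H = ⌊ all? (λ j → ∣ H j ∣ N.≟ toℕ (i j)) ⌋

profile : {M : ℕ} {m : Fin M → ℕ} → MultiFamily M m → Matrix M m ℕ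
profile 𝓕 i = length (filter (λ H → hasProfile i H BP.≟ Bool.true) 𝓕)

-- A product-permutation 𝓛: a linear ordering of each block X_j, given by a
-- permutation σ_j of Fin (m j); element x of X_j sits at position σ_j x
-- (positions 0, 1, ..., m j - 1).
ProductPermutation : (M : ℕ) → (Fin M → ℕ) → Set
ProductPermutation M m = (j : Fin M) → Permutation′ (m j)

firstElems : {n : ℕ} → Permutation′ n → ℕ → Subset n
firstElems σ k = tabulate (λ x → toℕ (σ ⟨$⟩ʳ x) <ᵇ k)

IsInitial : {M : ℕ} {m : Fin M → ℕ} → ProductPermutation M m → SubsetX M m → Set
IsInitial 𝓛 H = ∀ j → H j ≡ firstElems (𝓛 j) ∣ H j ∣

isInitial? : {M : ℕ} {m : Fin M → ℕ} (𝓛 : ProductPermutation M m) →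
             (H : SubsetX M m) → Dec (IsInitial 𝓛 H)
isInitial? 𝓛 H = all? (λ j → ≡-dec BP._≟_ (H j) (firstElems (𝓛 j) ∣ H j ∣))

restrict : {M : ℕ} {m : Fin M → ℕ} → ProductPermutation M m →
           MultiFamily M m → MultiFamily M m
restrict 𝓛 𝓗 = filter (isInitial? 𝓛) 𝓗

restrictFam : {M : ℕ} {m : Fin M → ℕ} → ProductPermutation M m →
              FamilyOfMF M m → FamilyOfMF M m
restrictFam 𝓛 𝔄 = map (restrict 𝓛) 𝔄

InMu : {M : ℕ} {m : Fin M → ℕ} → FamilyOfMF M m → Matrix M m ℕ → Set
InMu 𝔄 P = ∃ λ 𝓕 → 𝓕 ∈ 𝔄 × (∀ i → profile 𝓕 i ≡ P i)

MultisetIndex : (M : ℕ) → (Fin M → ℕ) → Set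
MultisetIndex M m = List (Index M m)

sameIndex? : {M : ℕ} {m : Fin M → ℕ} (i i′ : Index M m) → Dec (∀ j → i j ≡ i′ j)
sameIndex? i i′ = all? (λ j → i j F.≟ i′ j)

T : {M : ℕ} {m : Fin M → ℕ} → MultisetIndex M m → Matrix M m ℕ
T I i = length (filter (λ i′ → sameIndex? i′ i) I)

prodFin : (n : ℕ) → (Fin n → ℕ) → ℕ
prodFin N.zero    f = 1
prodFin (N.suc n) f = f F.zero N.* prodFin n (λ j → f (F.suc j))

S : {M : ℕ} {m : Fin M → ℕ} → MultisetIndex M m → Matrix M m ℕ
S {M} {m} I i = T I i N.* prodFin M (λ j → m j C toℕ (i j))

toℚ : ℕ → ℚ
toℚ n = (+ n) / 1

sumℚ : List ℚ → ℚ
sumℚ [] = 0ℚ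
sumℚ (x ∷ xs) = x + sumℚ xs

combo : {M : ℕ} {m : Fin M → ℕ} → List (ℚ × Matrix M m ℚ) → Matrix M m ℚ
combo [] i = 0ℚ
combo ((c , y) ∷ cs) i = c * y i + combo cs i

InConvexHull : {M : ℕ} {m : Fin M → ℕ} → (Matrix M m ℚ → Set) → Matrix M m ℚ → Set
InConvexHull G x =
  ∃ λ (cs : List (ℚ × Matrix _ _ ℚ)) →
      All (λ { (c , y) → 0ℚ Q.≤ c × G y }) cs
    × sumℚ (map proj₁ cs) ≡ 1ℚ
    × (∀ i → x i ≡ combo cs i)

asℚ : {M : ℕ} {m : Fin M → ℕ} → Matrix M m ℕ → Matrix M m ℚ
asℚ P i = toℚ (P i)

Generators : {M : ℕ} {m : Fin M → ℕ} → FamilyOfMF M m → ProductPermutation M m →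
             Matrix M m ℚ → Set
Generators 𝔄 𝓛 y =
  ∃ λ (I : MultisetIndex _ _) → InMu (restrictFam 𝓛 𝔄) (T I) × (∀ i → y i ≡ toℚ (S I i))

-- Proof by averaging.  For a product-permutation 𝓛 let I(𝓛) be the multiset of
-- profile indices of the members of 𝓕 initial for 𝓛, so T(I(𝓛)) = 𝓟(𝓕(𝓛)) ∈
-- μ(𝔄(𝓛)) = μ(𝔄(𝓛₀)) and S(I(𝓛)) is a generator.  A set H with
-- ∣H ∩ X_j∣ = k_j is initial for exactly ∏_j k_j! (m_j − k_j)! product-
-- permutations, and k! (m − k)! · C(m, k) = m!, so double counting gives
--     Σ_𝓛 S(I(𝓛)) = (∏_j m_j!) · 𝓟(𝓕),
-- i.e. 𝓟(𝓕) is the uniform average of the generators S(I(𝓛)).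
module Submission where

open import Defs
open import Data.Nat using (ℕ; _≤_)
open import Data.Fin using (Fin)

open import Data.Nat using (zero; suc; _+_; _*_; _∸_; z≤n; s≤s; _<ᵇ_; _!; _≤?_; NonZero; pred)
import Data.Nat as ℕ
import Data.Nat.Properties as ℕP
open import Data.Nat.Combinatorics using (_C_; nCk≡n!/k![n-k]!; k![n∸k]!∣n!)
open import Data.Nat.DivMod using (m*[n/m]≡n)
open import Data.Nat.Tactic.RingSolver using (solve-∀)
open import Data.Bool using (Bool; true; false; _∧_; not)
import Data.Bool.Properties as BoolP
open import Data.Fin using (toℕ; fromℕ<; punchIn) renaming (zero to fzero; suc to fsuc)
open import Data.Fin.Properties using (all?; toℕ-fromℕ<; toℕ-injective)
open import Data.Fin.Subset using (Subset; ∣_∣)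
open import Data.Fin.Subset.Properties using (∣p∣≤n)
open import Data.Fin.Permutation using (Permutation′; _⟨$⟩ʳ_; insert; id)
open import Data.Vec using (_∷_; [])
open import Data.Vec.Properties using (≡-dec; tabulate-cong)
open import Data.List using (List; []; _∷_; _++_; map; filter; length; allFin; cartesianProductWith)
open import Data.List.Properties using (map-tabulate; length-tabulate)
import Data.Integer as ℤ
import Data.Integer.Properties as ℤP
open import Data.Rational using (ℚ; mkℚ; 0ℚ; 1ℚ; 1/_)
import Data.Rational as ℚ
import Data.Rational.Properties as ℚP
import Data.Nat.Coprimality as Coprime
open import Data.Product using (_,_; proj₁)
open import Data.List.Membership.Propositional.Properties using (∈-map⁺)
import Data.List.Relation.Unary.All as All
import Data.List.Relation.Unary.All.Properties as All
open import Function using (_∘_; mk⇔; Equivalence)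
open import Relation.Binary.PropositionalEquality
open import Relation.Nullary using (does; yes; no)
open import Relation.Nullary.Decidable using (does-⇔; isYes≗does; toWitness)
open import Relation.Unary using (Pred; Decidable)

𝟙 : Bool → ℕ
𝟙 true  = 1
𝟙 false = 0

𝟙-∧ : ∀ a b → 𝟙 (a ∧ b) ≡ 𝟙 a * 𝟙 b
𝟙-∧ true  b = sym (ℕP.*-identityˡ (𝟙 b))
𝟙-∧ false b = refl

∑ : {A : Set} → List A → (A → ℕ) → ℕ
∑ []       f = 0
∑ (x ∷ xs) f = f x + ∑ xs f

syntax ∑ xs (λ x → e) = ∑[ x ← xs ] e

module _ {A : Set} where

  ∑-cong : (xs : List A) {f g : A → ℕ} → (∀ x → f x ≡ g x) → ∑ xs f ≡ ∑ xs g
  ∑-cong []       f≗g = refl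
  ∑-cong (x ∷ xs) f≗g = cong₂ _+_ (f≗g x) (∑-cong xs f≗g)

  ∑-*ˡ : (xs : List A) (c : ℕ) (f : A → ℕ) → ∑[ x ← xs ] (c * f x) ≡ c * ∑ xs f
  ∑-*ˡ []       c f = sym (ℕP.*-zeroʳ c)
  ∑-*ˡ (x ∷ xs) c f = trans (cong (c * f x +_) (∑-*ˡ xs c f)) (sym (ℕP.*-distribˡ-+ c (f x) _))

  ∑-*ʳ : (xs : List A) (c : ℕ) (f : A → ℕ) → ∑[ x ← xs ] (f x * c) ≡ ∑ xs f * c
  ∑-*ʳ []       c f = refl
  ∑-*ʳ (x ∷ xs) c f = trans (cong (f x * c +_) (∑-*ʳ xs c f)) (sym (ℕP.*-distribʳ-+ c (f x) _))

  ∑-+ : (xs : List A) (f g : A → ℕ) → ∑[ x ← xs ] (f x + g x) ≡ ∑ xs f + ∑ xs g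
  ∑-+ []       f g = refl
  ∑-+ (x ∷ xs) f g = trans (cong (f x + g x +_) (∑-+ xs f g)) (interchange (f x) (g x) _ _)
    where
    interchange : ∀ a b c d → (a + b) + (c + d) ≡ (a + c) + (b + d)
    interchange = solve-∀

  ∑-++ : (xs ys : List A) (f : A → ℕ) → ∑ (xs ++ ys) f ≡ ∑ xs f + ∑ ys f
  ∑-++ []       ys f = refl
  ∑-++ (x ∷ xs) ys f = trans (cong (f x +_) (∑-++ xs ys f)) (sym (ℕP.+-assoc (f x) _ _))

  ∑-const : (xs : List A) (c : ℕ) → ∑[ x ← xs ] c ≡ length xs * c
  ∑-const []       c = refl
  ∑-const (x ∷ xs) c = cong (c +_) (∑-const xs c)

  ∑-filter : ∀ {ℓ} {P : Pred A ℓ} (P? : Decidable P) (xs : List A) (f : A → ℕ) →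
             ∑ (filter P? xs) f ≡ ∑[ x ← xs ] (𝟙 (does (P? x)) * f x)
  ∑-filter P? []       f = refl
  ∑-filter P? (x ∷ xs) f with does (P? x)
  ... | true  = cong₂ _+_ (sym (ℕP.+-identityʳ (f x))) (∑-filter P? xs f)
  ... | false = ∑-filter P? xs f

module _ {A B : Set} where

  ∑-map : (g : A → B) (xs : List A) (f : B → ℕ) → ∑ (map g xs) f ≡ ∑[ x ← xs ] f (g x)
  ∑-map g []       f = refl
  ∑-map g (x ∷ xs) f = cong (f (g x) +_) (∑-map g xs f)

  ∑-swap : (xs : List A) (ys : List B) (f : A → B → ℕ) →
           ∑[ x ← xs ] ∑ ys (f x) ≡ ∑[ y ← ys ] ∑[ x ← xs ] f x y
  ∑-swap []       ys f = sym (trans (∑-const ys 0) (ℕP.*-zeroʳ (length ys)))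
  ∑-swap (x ∷ xs) ys f = trans (cong (∑ ys (f x) +_) (∑-swap xs ys f))
                               (sym (∑-+ ys (f x) (λ y → ∑[ x ← xs ] f x y)))

-- A sum over all pairs f a b of a function that factors as u a * v b
-- factors into the product of the two sums.  This is how all counts over
-- permutations and product-permutations are evaluated.
∑-cartesianProduct : {A B C : Set} (f : A → B → C) (xs : List A) (ys : List B)
                     (g : C → ℕ) (u : A → ℕ) (v : B → ℕ) →
                     (∀ a b → g (f a b) ≡ u a * v b) →
                     ∑ (cartesianProductWith f xs ys) g ≡ ∑ xs u * ∑ ys v
∑-cartesianProduct f []       ys g u v g≡uv = refl
∑-cartesianProduct f (x ∷ xs) ys g u v g≡uv = begin
  ∑ (map (f x) ys ++ cartesianProductWith f xs ys) g     ≡⟨ ∑-++ (map (f x) ys) _ g ⟩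
  ∑ (map (f x) ys) g + ∑ (cartesianProductWith f xs ys) g
    ≡⟨ cong₂ _+_ (trans (∑-map (f x) ys g) (trans (∑-cong ys (g≡uv x)) (∑-*ˡ ys (u x) v)))
                 (∑-cartesianProduct f xs ys g u v g≡uv) ⟩
  u x * ∑ ys v + ∑ xs u * ∑ ys v                         ≡⟨ sym (ℕP.*-distribʳ-+ (∑ ys v) (u x) _) ⟩
  (u x + ∑ xs u) * ∑ ys v                                ∎
  where open ≡-Reasoning

length≡∑ : {A : Set} (xs : List A) → length xs ≡ ∑[ x ← xs ] 1
length≡∑ xs = sym (trans (∑-const xs 1) (ℕP.*-identityʳ (length xs)))

∑-allFin-suc : (n : ℕ) (f : Fin (suc n) → ℕ) →
               ∑ (allFin (suc n)) f ≡ f fzero + ∑[ p ← allFin n ] f (fsuc p)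
∑-allFin-suc n f =
  cong (f fzero +_) (trans (cong (λ ps → ∑ ps f) (sym (map-tabulate (λ p → p) fsuc)))
                           (∑-map fsuc (allFin n) f))

count-below : ∀ N t → t ≤ N → ∑[ p ← allFin N ] 𝟙 (toℕ p <ᵇ t) ≡ t
count-below zero    zero    _         = refl
count-below (suc N) zero    _         = trans (∑-allFin-suc N (λ p → 𝟙 (toℕ p <ᵇ 0))) (count-below N zero z≤n)
count-below (suc N) (suc t) (s≤s t≤N) =
  trans (∑-allFin-suc N (λ p → 𝟙 (toℕ p <ᵇ suc t))) (cong suc (count-below N t t≤N))

count-above : ∀ N t → t ≤ N → ∑[ p ← allFin N ] 𝟙 (not (toℕ p <ᵇ t)) ≡ N ∸ t
count-above zero    zero    _         = refl
count-above (suc N) zero    _         =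
  trans (∑-allFin-suc N (λ p → 𝟙 (not (toℕ p <ᵇ 0)))) (cong suc (count-above N zero z≤n))
count-above (suc N) (suc t) (s≤s t≤N) =
  trans (∑-allFin-suc N (λ p → 𝟙 (not (toℕ p <ᵇ suc t)))) (count-above N t t≤N)

-- An enumeration of the permutations of Fin n: a permutation of Fin (suc n)
-- is determined by the image p of 0 and a permutation τ of the rest.
permutations : (n : ℕ) → List (Permutation′ n)
permutations zero    = id ∷ []
permutations (suc n) = cartesianProductWith (insert fzero) (allFin (suc n)) (permutations n)

length-permutations : ∀ n → length (permutations n) ≡ n !
length-permutations zero    = refl
length-permutations (suc n) = begin
  length (permutations (suc n))                           ≡⟨ length≡∑ (permutations (suc n)) ⟩
  ∑[ σ ← permutations (suc n) ] 1
    ≡⟨ ∑-cartesianProduct (insert fzero) (allFin (suc n)) (permutations n)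
                          (λ _ → 1) (λ _ → 1) (λ _ → 1) (λ _ _ → refl) ⟩
  ∑[ p ← allFin (suc n) ] 1 * ∑[ τ ← permutations n ] 1
    ≡⟨ cong₂ _*_ (sym (length≡∑ (allFin (suc n)))) (sym (length≡∑ (permutations n))) ⟩
  length (allFin (suc n)) * length (permutations n)
    ≡⟨ cong₂ _*_ (length-tabulate {n = suc n} (λ p → p)) (length-permutations n) ⟩
  suc n * n !                                              ∎
  where open ≡-Reasoning

initialᵇ : ∀ {n} → Subset n → Permutation′ n → Bool
initialᵇ A σ = does (≡-dec BoolP._≟_ A (firstElems σ ∣ A ∣))

initialCount : ∀ n → Subset n → ℕ
initialCount n A = ∑[ σ ← permutations n ] 𝟙 (initialᵇ A σ)

punchIn-<ᵇ-below : ∀ {n} (p : Fin (suc n)) (q : Fin n) k → toℕ p ≤ k →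
                   (toℕ (punchIn p q) <ᵇ suc k) ≡ (toℕ q <ᵇ k)
punchIn-<ᵇ-below fzero    q        k       _         = refl
punchIn-<ᵇ-below (fsuc p) fzero    (suc k) _         = refl
punchIn-<ᵇ-below (fsuc p) (fsuc q) (suc k) (s≤s p≤k) = punchIn-<ᵇ-below p q k p≤k

punchIn-<ᵇ-above : ∀ {n} (p : Fin (suc n)) (q : Fin n) k → k ≤ toℕ p →
                   (toℕ (punchIn p q) <ᵇ k) ≡ (toℕ q <ᵇ k)
punchIn-<ᵇ-above fzero    q        zero    _         = refl
punchIn-<ᵇ-above (fsuc p) fzero    k       _         = refl
punchIn-<ᵇ-above (fsuc p) (fsuc q) zero    _         = refl
punchIn-<ᵇ-above (fsuc p) (fsuc q) (suc k) (s≤s k≤p) = punchIn-<ᵇ-above p q k k≤p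

<ᵇ-true : ∀ m n → m ℕ.< n → (m <ᵇ n) ≡ true
<ᵇ-true zero    (suc n) _         = refl
<ᵇ-true (suc m) (suc n) (s≤s m<n) = <ᵇ-true m n m<n

<ᵇ-false : ∀ m n → n ≤ m → (m <ᵇ n) ≡ false
<ᵇ-false m       zero    _         = refl
<ᵇ-false (suc m) (suc n) (s≤s n≤m) = <ᵇ-false m n n≤m

-- Whether the first element of a ∷ A' may be sent to position p by an
-- ordering for which a ∷ A' is initial.
headFits : ∀ {n} → Bool → Subset n → Fin (suc n) → Bool
headFits a A' p = does (a BoolP.≟ (toℕ p <ᵇ ∣ a ∷ A' ∣))

initial-insert : ∀ {n} a (A' : Subset n) p τ →
  𝟙 (initialᵇ (a ∷ A') (insert fzero p τ)) ≡ 𝟙 (headFits a A' p) * 𝟙 (initialᵇ A' τ)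
initial-insert true A' p τ with toℕ p ≤? ∣ A' ∣
... | yes p≤k
  rewrite <ᵇ-true (toℕ p) (suc ∣ A' ∣) (s≤s p≤k)
        | tabulate-cong {f = λ y → toℕ (punchIn p (τ ⟨$⟩ʳ y)) <ᵇ suc ∣ A' ∣}
                        {g = λ y → toℕ (τ ⟨$⟩ʳ y) <ᵇ ∣ A' ∣}
                        (λ y → punchIn-<ᵇ-below p (τ ⟨$⟩ʳ y) ∣ A' ∣ p≤k)
  = sym (ℕP.*-identityˡ _)
... | no p≰k rewrite <ᵇ-false (toℕ p) (suc ∣ A' ∣) (ℕP.≰⇒> p≰k) = refl
initial-insert false A' p τ with ∣ A' ∣ ≤? toℕ p
... | yes k≤p
  rewrite <ᵇ-false (toℕ p) ∣ A' ∣ k≤p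
        | tabulate-cong {f = λ y → toℕ (punchIn p (τ ⟨$⟩ʳ y)) <ᵇ ∣ A' ∣}
                        {g = λ y → toℕ (τ ⟨$⟩ʳ y) <ᵇ ∣ A' ∣}
                        (λ y → punchIn-<ᵇ-above p (τ ⟨$⟩ʳ y) ∣ A' ∣ k≤p)
  = sym (ℕP.*-identityˡ _)
... | no k≰p rewrite <ᵇ-true (toℕ p) ∣ A' ∣ (ℕP.≰⇒> k≰p) = refl

count-headFits-true : ∀ {n} (A' : Subset n) →
  ∑[ p ← allFin (suc n) ] 𝟙 (headFits true A' p) ≡ suc ∣ A' ∣
count-headFits-true {n} A' =
  trans (∑-cong (allFin (suc n)) (λ p → cong 𝟙 (fits p)))
        (count-below (suc n) (suc ∣ A' ∣) (s≤s (∣p∣≤n A')))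
  where
  fits : ∀ p → headFits true A' p ≡ (toℕ p <ᵇ suc ∣ A' ∣)
  fits p with toℕ p <ᵇ suc ∣ A' ∣
  ... | true  = refl
  ... | false = refl

count-headFits-false : ∀ {n} (A' : Subset n) →
  ∑[ p ← allFin (suc n) ] 𝟙 (headFits false A' p) ≡ suc n ∸ ∣ A' ∣
count-headFits-false {n} A' =
  trans (∑-cong (allFin (suc n)) (λ p → cong 𝟙 (fits p)))
        (count-above (suc n) ∣ A' ∣ (ℕP.m≤n⇒m≤1+n (∣p∣≤n A')))
  where
  fits : ∀ p → headFits false A' p ≡ not (toℕ p <ᵇ ∣ A' ∣)
  fits p with toℕ p <ᵇ ∣ A' ∣
  ... | true  = refl
  ... | false = refl

initialCount-cons : ∀ {n} a (A' : Subset n) →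
  initialCount (suc n) (a ∷ A') ≡ ∑[ p ← allFin (suc n) ] 𝟙 (headFits a A' p) * initialCount n A'
initialCount-cons {n} a A' =
  ∑-cartesianProduct (insert fzero) (allFin (suc n)) (permutations n)
    (λ σ → 𝟙 (initialᵇ (a ∷ A') σ)) (λ p → 𝟙 (headFits a A' p)) (λ τ → 𝟙 (initialᵇ A' τ))
    (initial-insert a A')

initialCount-value : ∀ n (A : Subset n) → initialCount n A ≡ ∣ A ∣ ! * (n ∸ ∣ A ∣) !
initialCount-value zero    []         = refl
initialCount-value (suc n) (true ∷ A') = begin
  initialCount (suc n) (true ∷ A')  ≡⟨ initialCount-cons true A' ⟩
  ∑[ p ← allFin (suc n) ] 𝟙 (headFits true A' p) * initialCount n A'
                                    ≡⟨ cong₂ _*_ (count-headFits-true A') (initialCount-value n A') ⟩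
  suc k * (k ! * (n ∸ k) !)         ≡⟨ sym (ℕP.*-assoc (suc k) (k !) _) ⟩
  suc k ! * (n ∸ k) !               ∎
  where open ≡-Reasoning
        k = ∣ A' ∣
initialCount-value (suc n) (false ∷ A') = begin
  initialCount (suc n) (false ∷ A') ≡⟨ initialCount-cons false A' ⟩
  ∑[ p ← allFin (suc n) ] 𝟙 (headFits false A' p) * initialCount n A'
                                    ≡⟨ cong₂ _*_ (count-headFits-false A') (initialCount-value n A') ⟩
  (suc n ∸ k) * (k ! * (n ∸ k) !)   ≡⟨ cong (_* (k ! * (n ∸ k) !)) (ℕP.+-∸-assoc 1 (∣p∣≤n A')) ⟩
  suc (n ∸ k) * (k ! * (n ∸ k) !)   ≡⟨ exchange (n ∸ k) (k !) ((n ∸ k) !) ⟩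
  k ! * suc (n ∸ k) !               ≡⟨ cong (λ d → k ! * d !) (sym (ℕP.+-∸-assoc 1 (∣p∣≤n A'))) ⟩
  k ! * (suc n ∸ k) !               ∎
  where open ≡-Reasoning
        k = ∣ A' ∣
        exchange : ∀ d x y → suc d * (x * y) ≡ x * (suc d * y)
        exchange = solve-∀

initialCount-binomial : ∀ n (A : Subset n) → initialCount n A * (n C ∣ A ∣) ≡ n !
initialCount-binomial n A = begin
  initialCount n A * (n C k)                        ≡⟨ cong₂ _*_ (initialCount-value n A) (nCk≡n!/k![n-k]! k≤n) ⟩
  (k ! * (n ∸ k) !) * (n ! ℕ./ (k ! * (n ∸ k) !))   ≡⟨ m*[n/m]≡n (k![n∸k]!∣n! k≤n) ⟩
  n !                                               ∎
  where open ≡-Reasoning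
        k   = ∣ A ∣
        k≤n = ∣p∣≤n A
        instance _ = ℕP._!*_!≢0 k (n ∸ k)

prodFin-cong : ∀ n {f g : Fin n → ℕ} → (∀ j → f j ≡ g j) → prodFin n f ≡ prodFin n g
prodFin-cong zero    f≗g = refl
prodFin-cong (suc n) f≗g = cong₂ _*_ (f≗g fzero) (prodFin-cong n (f≗g ∘ fsuc))

prodFin-nonZero : ∀ n (f : Fin n → ℕ) → (∀ j → NonZero (f j)) → NonZero (prodFin n f)
prodFin-nonZero zero    f f≢0 = _
prodFin-nonZero (suc n) f f≢0 =
  ℕP.m*n≢0 (f fzero) (prodFin n (f ∘ fsuc))
    {{f≢0 fzero}} {{prodFin-nonZero n (f ∘ fsuc) (f≢0 ∘ fsuc)}}

consPP : ∀ {M} {m : Fin (suc M) → ℕ} → Permutation′ (m fzero) →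
         ProductPermutation M (m ∘ fsuc) → ProductPermutation (suc M) m
consPP σ 𝓛 fzero    = σ
consPP σ 𝓛 (fsuc j) = 𝓛 j

productPermutations : (M : ℕ) (m : Fin M → ℕ) → List (ProductPermutation M m)
productPermutations zero    m = (λ ()) ∷ []
productPermutations (suc M) m =
  cartesianProductWith consPP (permutations (m fzero)) (productPermutations M (m ∘ fsuc))

length-productPermutations : ∀ M m → length (productPermutations M m) ≡ prodFin M (λ j → m j !)
length-productPermutations zero    m = refl
length-productPermutations (suc M) m = begin
  length (productPermutations (suc M) m)
    ≡⟨ length≡∑ (productPermutations (suc M) m) ⟩
  ∑[ 𝓛 ← productPermutations (suc M) m ] 1
    ≡⟨ ∑-cartesianProduct (consPP {m = m}) (permutations (m fzero)) (productPermutations M (m ∘ fsuc))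
                          (λ _ → 1) (λ _ → 1) (λ _ → 1) (λ _ _ → refl) ⟩
  ∑[ σ ← permutations (m fzero) ] 1 * ∑[ 𝓛 ← productPermutations M (m ∘ fsuc) ] 1
    ≡⟨ cong₂ _*_ (sym (length≡∑ (permutations (m fzero))))
                 (sym (length≡∑ (productPermutations M (m ∘ fsuc)))) ⟩
  length (permutations (m fzero)) * length (productPermutations M (m ∘ fsuc))
    ≡⟨ cong₂ _*_ (length-permutations (m fzero)) (length-productPermutations M (m ∘ fsuc)) ⟩
  m fzero ! * prodFin M (λ j → m (fsuc j) !)
    ∎
  where open ≡-Reasoning

module _ {M : ℕ} {m : Fin M → ℕ} where

  initialᵇX : ProductPermutation M m → SubsetX M m → Bool
  initialᵇX 𝓛 H = does (isInitial? 𝓛 H)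

initialCountX : ∀ M m → SubsetX M m → ℕ
initialCountX M m H = ∑[ 𝓛 ← productPermutations M m ] 𝟙 (initialᵇX 𝓛 H)

-- Being initial is checked block by block, so the count factorises, and
-- H is initial for ∏_j m_j! / C(m_j, ∣H ∩ X_j∣) product-permutations.
initialCountX-binomial : ∀ M m (H : SubsetX M m) →
  initialCountX M m H * prodFin M (λ j → m j C ∣ H j ∣) ≡ prodFin M (λ j → m j !)
initialCountX-binomial zero    m H = refl
initialCountX-binomial (suc M) m H = begin
  initialCountX (suc M) m H * (c₀ * cs)
    ≡⟨ cong (_* (c₀ * cs)) factorise ⟩
  (initialCount (m fzero) H₀ * initialCountX M (m ∘ fsuc) Hs) * (c₀ * cs)
    ≡⟨ interchange (initialCount (m fzero) H₀) _ _ _ ⟩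
  (initialCount (m fzero) H₀ * c₀) * (initialCountX M (m ∘ fsuc) Hs * cs)
    ≡⟨ cong₂ _*_ (initialCount-binomial (m fzero) H₀) (initialCountX-binomial M (m ∘ fsuc) Hs) ⟩
  m fzero ! * prodFin M (λ j → m (fsuc j) !)
    ∎
  where
  open ≡-Reasoning
  H₀ = H fzero
  Hs = H ∘ fsuc
  c₀ = m fzero C ∣ H₀ ∣
  cs = prodFin M (λ j → m (fsuc j) C ∣ Hs j ∣)
  factorise : initialCountX (suc M) m H ≡ initialCount (m fzero) H₀ * initialCountX M (m ∘ fsuc) Hs
  factorise =
    ∑-cartesianProduct (consPP {m = m}) (permutations (m fzero)) (productPermutations M (m ∘ fsuc))
      (λ 𝓛 → 𝟙 (initialᵇX 𝓛 H)) (λ σ → 𝟙 (initialᵇ H₀ σ)) (λ 𝓛 → 𝟙 (initialᵇX 𝓛 Hs))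
      (λ σ 𝓛 → 𝟙-∧ (initialᵇ H₀ σ) (initialᵇX 𝓛 Hs))
  interchange : ∀ a b c d → (a * b) * (c * d) ≡ (a * c) * (b * d)
  interchange = solve-∀

module _ {M : ℕ} {m : Fin M → ℕ} where

  profileIndex : SubsetX M m → Index M m
  profileIndex H j = fromℕ< (s≤s (∣p∣≤n (H j)))

  sameIndex-profileIndex : ∀ H i → does (sameIndex? (profileIndex H) i) ≡ hasProfile i H
  sameIndex-profileIndex H i = begin
    does (sameIndex? (profileIndex H) i)       ≡⟨ does-⇔ (mk⇔ to from) (sameIndex? (profileIndex H) i) (all? sizes) ⟩
    does (all? sizes)                          ≡⟨ sym (isYes≗does (all? sizes)) ⟩
    hasProfile i H                             ∎
    where
    open ≡-Reasoning
    sizes = λ j → ∣ H j ∣ ℕ.≟ toℕ (i j)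
    toℕ-profileIndex : ∀ j → toℕ (profileIndex H j) ≡ ∣ H j ∣
    toℕ-profileIndex j = toℕ-fromℕ< (s≤s (∣p∣≤n (H j)))
    to : (∀ j → profileIndex H j ≡ i j) → (∀ j → ∣ H j ∣ ≡ toℕ (i j))
    to eq j = trans (sym (toℕ-profileIndex j)) (cong toℕ (eq j))
    from : (∀ j → ∣ H j ∣ ≡ toℕ (i j)) → (∀ j → profileIndex H j ≡ i j)
    from eq j = toℕ-injective (trans (toℕ-profileIndex j) (eq j))

  profile-∑ : ∀ (𝓕 : MultiFamily M m) i → profile 𝓕 i ≡ ∑[ H ← 𝓕 ] 𝟙 (hasProfile i H)
  profile-∑ 𝓕 i = begin
    length (filter hasProfile? 𝓕)                          ≡⟨ length≡∑ (filter hasProfile? 𝓕) ⟩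
    ∑[ H ← filter hasProfile? 𝓕 ] 1                        ≡⟨ ∑-filter hasProfile? 𝓕 (λ _ → 1) ⟩
    ∑[ H ← 𝓕 ] (𝟙 (does (hasProfile? H)) * 1)              ≡⟨ ∑-cong 𝓕 indicator ⟩
    ∑[ H ← 𝓕 ] 𝟙 (hasProfile i H)                          ∎
    where
    open ≡-Reasoning
    hasProfile? = λ H → hasProfile i H BoolP.≟ true
    indicator : ∀ H → 𝟙 (does (hasProfile? H)) * 1 ≡ 𝟙 (hasProfile i H)
    indicator H with hasProfile i H
    ... | true  = refl
    ... | false = refl

  T-profileIndices : ∀ (𝓕 : MultiFamily M m) i → T (map profileIndex 𝓕) i ≡ profile 𝓕 i
  T-profileIndices 𝓕 i = begin
    length (filter (λ i′ → sameIndex? i′ i) (map profileIndex 𝓕))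
      ≡⟨ length≡∑ (filter (λ i′ → sameIndex? i′ i) (map profileIndex 𝓕)) ⟩
    ∑[ i′ ← filter (λ i′ → sameIndex? i′ i) (map profileIndex 𝓕) ] 1
      ≡⟨ ∑-filter (λ i′ → sameIndex? i′ i) (map profileIndex 𝓕) (λ _ → 1) ⟩
    ∑[ i′ ← map profileIndex 𝓕 ] (𝟙 (does (sameIndex? i′ i)) * 1)
      ≡⟨ ∑-map profileIndex 𝓕 (λ i′ → 𝟙 (does (sameIndex? i′ i)) * 1) ⟩
    ∑[ H ← 𝓕 ] (𝟙 (does (sameIndex? (profileIndex H) i)) * 1)
      ≡⟨ ∑-cong 𝓕 (λ H → trans (ℕP.*-identityʳ _) (cong 𝟙 (sameIndex-profileIndex H i))) ⟩
    ∑[ H ← 𝓕 ] 𝟙 (hasProfile i H)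
      ≡⟨ sym (profile-∑ 𝓕 i) ⟩
    profile 𝓕 i
      ∎
    where open ≡-Reasoning

  initialProfiles : ProductPermutation M m → MultiFamily M m → MultisetIndex M m
  initialProfiles 𝓛 𝓕 = map profileIndex (restrict 𝓛 𝓕)

  binomialWeight : Index M m → ℕ
  binomialWeight i = prodFin M (λ j → m j C toℕ (i j))

  orderings : ℕ
  orderings = prodFin M (λ j → m j !)

  T-initialProfiles : ∀ 𝓛 (𝓕 : MultiFamily M m) i →
    T (initialProfiles 𝓛 𝓕) i ≡ ∑[ H ← 𝓕 ] (𝟙 (initialᵇX 𝓛 H) * 𝟙 (hasProfile i H))
  T-initialProfiles 𝓛 𝓕 i = begin
    T (initialProfiles 𝓛 𝓕) i     ≡⟨ T-profileIndices (restrict 𝓛 𝓕) i ⟩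
    profile (restrict 𝓛 𝓕) i      ≡⟨ profile-∑ (restrict 𝓛 𝓕) i ⟩
    ∑[ H ← restrict 𝓛 𝓕 ] 𝟙 (hasProfile i H)
                                  ≡⟨ ∑-filter (isInitial? 𝓛) 𝓕 (λ H → 𝟙 (hasProfile i H)) ⟩
    ∑[ H ← 𝓕 ] (𝟙 (initialᵇX 𝓛 H) * 𝟙 (hasProfile i H)) ∎
    where open ≡-Reasoning

  initialCountX-weighted : ∀ i H →
    initialCountX M m H * (𝟙 (hasProfile i H) * binomialWeight i) ≡ 𝟙 (hasProfile i H) * orderings
  initialCountX-weighted i H with hasProfile i H in eq
  ... | false = ℕP.*-zeroʳ (initialCountX M m H)
  ... | true  = begin
    initialCountX M m H * (1 * binomialWeight i)
      ≡⟨ cong (initialCountX M m H *_) (ℕP.*-identityˡ _) ⟩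
    initialCountX M m H * binomialWeight i
      ≡⟨ cong (initialCountX M m H *_) (prodFin-cong M (λ j → cong (m j C_) (sym (sizes j)))) ⟩
    initialCountX M m H * prodFin M (λ j → m j C ∣ H j ∣)
      ≡⟨ initialCountX-binomial M m H ⟩
    orderings
      ≡⟨ sym (ℕP.*-identityˡ _) ⟩
    1 * orderings
      ∎
    where
    open ≡-Reasoning
    sizes : ∀ j → ∣ H j ∣ ≡ toℕ (i j)
    sizes = toWitness (Equivalence.from BoolP.T-≡ eq)

  ∑-S-initialProfiles : ∀ (𝓕 : MultiFamily M m) i →
    ∑[ 𝓛 ← productPermutations M m ] S (initialProfiles 𝓛 𝓕) i ≡ profile 𝓕 i * orderings
  ∑-S-initialProfiles 𝓕 i = begin
    ∑[ 𝓛 ← 𝓛s ] (T (initialProfiles 𝓛 𝓕) i * binomialWeight i)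
      ≡⟨ ∑-cong 𝓛s (λ 𝓛 → cong (_* binomialWeight i) (T-initialProfiles 𝓛 𝓕 i)) ⟩
    ∑[ 𝓛 ← 𝓛s ] (∑[ H ← 𝓕 ] (initial 𝓛 H * hasP H) * binomialWeight i)
      ≡⟨ ∑-cong 𝓛s (λ 𝓛 → sym (∑-*ʳ 𝓕 (binomialWeight i) (λ H → initial 𝓛 H * hasP H))) ⟩
    ∑[ 𝓛 ← 𝓛s ] ∑[ H ← 𝓕 ] (initial 𝓛 H * hasP H * binomialWeight i)
      ≡⟨ ∑-swap 𝓛s 𝓕 (λ 𝓛 H → initial 𝓛 H * hasP H * binomialWeight i) ⟩
    ∑[ H ← 𝓕 ] ∑[ 𝓛 ← 𝓛s ] (initial 𝓛 H * hasP H * binomialWeight i)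
      ≡⟨ ∑-cong 𝓕 per-member ⟩
    ∑[ H ← 𝓕 ] (hasP H * orderings)
      ≡⟨ ∑-*ʳ 𝓕 orderings hasP ⟩
    ∑[ H ← 𝓕 ] hasP H * orderings
      ≡⟨ cong (_* orderings) (sym (profile-∑ 𝓕 i)) ⟩
    profile 𝓕 i * orderings
      ∎
    where
    open ≡-Reasoning
    𝓛s = productPermutations M m
    initial = λ 𝓛 H → 𝟙 (initialᵇX 𝓛 H)
    hasP = λ H → 𝟙 (hasProfile i H)
    per-member : ∀ H → ∑[ 𝓛 ← 𝓛s ] (initial 𝓛 H * hasP H * binomialWeight i) ≡ hasP H * orderings
    per-member H = begin
      ∑[ 𝓛 ← 𝓛s ] (initial 𝓛 H * hasP H * binomialWeight i)
        ≡⟨ ∑-cong 𝓛s (λ 𝓛 → ℕP.*-assoc (initial 𝓛 H) (hasP H) (binomialWeight i)) ⟩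
      ∑[ 𝓛 ← 𝓛s ] (initial 𝓛 H * (hasP H * binomialWeight i))
        ≡⟨ ∑-*ʳ 𝓛s (hasP H * binomialWeight i) (λ 𝓛 → initial 𝓛 H) ⟩
      initialCountX M m H * (hasP H * binomialWeight i)
        ≡⟨ initialCountX-weighted i H ⟩
      hasP H * orderings
        ∎

toℚ≡mkℚ : ∀ n → toℚ n ≡ mkℚ (ℤ.+ n) 0 (Coprime.sym (Coprime.1-coprimeTo n))
toℚ≡mkℚ n = ℚP.normalize-coprime (Coprime.sym (Coprime.1-coprimeTo n))

toℚ-+ : ∀ a b → toℚ a ℚ.+ toℚ b ≡ toℚ (a + b)
toℚ-+ a b rewrite toℚ≡mkℚ a | toℚ≡mkℚ b =
  ℚP./-cong (trans (cong₂ ℤ._+_ (ℤP.*-identityʳ (ℤ.+ a)) (ℤP.*-identityʳ (ℤ.+ b))) (sym (ℤP.pos-+ a b))) refl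

toℚ-* : ∀ a b → toℚ a ℚ.* toℚ b ≡ toℚ (a * b)
toℚ-* a b rewrite toℚ≡mkℚ a | toℚ≡mkℚ b = ℚP./-cong (sym (ℤP.pos-* a b)) refl

uniformWeight : ℕ → ℚ
uniformWeight k = 1/ mkℚ (ℤ.+ suc k) 0 (Coprime.sym (Coprime.1-coprimeTo (suc k)))

uniformWeight-inverse : ∀ k → uniformWeight k ℚ.* toℚ (suc k) ≡ 1ℚ
uniformWeight-inverse k rewrite toℚ≡mkℚ (suc k) =
  ℚP.*-inverseˡ (mkℚ (ℤ.+ suc k) 0 (Coprime.sym (Coprime.1-coprimeTo (suc k))))

uniformWeight-nonNeg : ∀ k → 0ℚ ℚ.≤ uniformWeight k
uniformWeight-nonNeg k = ℚ.*≤* (ℤ.+≤+ z≤n)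

module _ {M : ℕ} {m : Fin M → ℕ} {A : Set} (w : ℚ) (g : A → Matrix M m ℕ) where

  combo-uniform : ∀ (xs : List A) i →
    combo (map (λ x → (w , asℚ (g x))) xs) i ≡ w ℚ.* toℚ (∑[ x ← xs ] g x i)
  combo-uniform []       i = sym (ℚP.*-zeroʳ w)
  combo-uniform (x ∷ xs) i = begin
    w ℚ.* toℚ (g x i) ℚ.+ combo (map (λ x → (w , asℚ (g x))) xs) i
      ≡⟨ cong (w ℚ.* toℚ (g x i) ℚ.+_) (combo-uniform xs i) ⟩
    w ℚ.* toℚ (g x i) ℚ.+ w ℚ.* toℚ (∑[ x ← xs ] g x i)
      ≡⟨ sym (ℚP.*-distribˡ-+ w (toℚ (g x i)) _) ⟩
    w ℚ.* (toℚ (g x i) ℚ.+ toℚ (∑[ x ← xs ] g x i))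
      ≡⟨ cong (w ℚ.*_) (toℚ-+ (g x i) _) ⟩
    w ℚ.* toℚ (g x i + ∑[ x ← xs ] g x i)
      ∎
    where open ≡-Reasoning

  coefficients-uniform : ∀ (xs : List A) →
    sumℚ (map proj₁ (map (λ x → (w , asℚ (g x))) xs)) ≡ w ℚ.* toℚ (length xs)
  coefficients-uniform []       = sym (ℚP.*-zeroʳ w)
  coefficients-uniform (x ∷ xs) = begin
    w ℚ.+ sumℚ (map proj₁ (map (λ x → (w , asℚ (g x))) xs))
      ≡⟨ cong₂ ℚ._+_ (sym (ℚP.*-identityʳ w)) (coefficients-uniform xs) ⟩
    w ℚ.* 1ℚ ℚ.+ w ℚ.* toℚ (length xs)
      ≡⟨ sym (ℚP.*-distribˡ-+ w 1ℚ _) ⟩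
    w ℚ.* (toℚ 1 ℚ.+ toℚ (length xs))
      ≡⟨ cong (w ℚ.*_) (toℚ-+ 1 (length xs)) ⟩
    w ℚ.* toℚ (suc (length xs))
      ∎
    where open ≡-Reasoning

average∈hull : ∀ {M : ℕ} {m : Fin M → ℕ} {A : Set} (G : Matrix M m ℚ → Set)
  (xs : List A) (g : A → Matrix M m ℕ) (P : Matrix M m ℕ) (k : ℕ) →
  length xs ≡ suc k → (∀ x → G (asℚ (g x))) →
  (∀ i → ∑[ x ← xs ] g x i ≡ P i * suc k) →
  InConvexHull G (asℚ P)
average∈hull G xs g P k length≡ g∈G ∑≡ = cs , coefficients-ok , total , entries
  where
  w  = uniformWeight k
  cs = map (λ x → (w , asℚ (g x))) xs
  coefficients-ok = All.map⁺ (All.universal (λ x → uniformWeight-nonNeg k , g∈G x) xs)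
  total : sumℚ (map proj₁ cs) ≡ 1ℚ
  total = trans (coefficients-uniform w g xs)
                (trans (cong (λ n → w ℚ.* toℚ n) length≡) (uniformWeight-inverse k))
  entries : ∀ i → asℚ P i ≡ combo cs i
  entries i = sym (begin
    combo cs i                              ≡⟨ combo-uniform w g xs i ⟩
    w ℚ.* toℚ (∑[ x ← xs ] g x i)           ≡⟨ cong (λ n → w ℚ.* toℚ n) (trans (∑≡ i) (ℕP.*-comm (P i) (suc k))) ⟩
    w ℚ.* toℚ (suc k * P i)                 ≡⟨ cong (w ℚ.*_) (sym (toℚ-* (suc k) (P i))) ⟩
    w ℚ.* (toℚ (suc k) ℚ.* toℚ (P i))       ≡⟨ sym (ℚP.*-assoc w (toℚ (suc k)) (toℚ (P i))) ⟩
    (w ℚ.* toℚ (suc k)) ℚ.* toℚ (P i)       ≡⟨ cong (ℚ._* toℚ (P i)) (uniformWeight-inverse k) ⟩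
    1ℚ ℚ.* toℚ (P i)                        ≡⟨ ℚP.*-identityˡ (toℚ (P i)) ⟩
    toℚ (P i)                               ∎)
    where open ≡-Reasoning

lemma5p1 : (M : ℕ) (m : Fin M → ℕ) → (∀ j → 1 ≤ m j) →
  (𝔄 : FamilyOfMF M m) →
  (∀ (𝓛 𝓛′ : ProductPermutation M m) (P : Matrix M m ℕ) →
     InMu (restrictFam 𝓛 𝔄) P → InMu (restrictFam 𝓛′ 𝔄) P) →
  (𝓛 : ProductPermutation M m) (P : Matrix M m ℕ) →
  InMu 𝔄 P → InConvexHull (Generators 𝔄 𝓛) (asℚ P)
lemma5p1 M m _ 𝔄 μ-independent 𝓛₀ P (𝓕 , 𝓕∈𝔄 , 𝓟𝓕≡P) =
  average∈hull (Generators 𝔄 𝓛₀) (productPermutations M m) (λ 𝓛 → S (initialProfiles 𝓛 𝓕)) P k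
    (trans (length-productPermutations M m) orderings≡suc)
    generator
    (λ i → trans (∑-S-initialProfiles 𝓕 i) (cong₂ _*_ (𝓟𝓕≡P i) orderings≡suc))
  where
  instance
    orderings≢0 : NonZero (orderings {M} {m})
    orderings≢0 = prodFin-nonZero M (λ j → m j !) (λ j → m j ℕP.!≢0)
  k = pred (orderings {M} {m})
  orderings≡suc : orderings {M} {m} ≡ suc k
  orderings≡suc = sym (ℕP.suc-pred (orderings {M} {m}))
  generator : ∀ 𝓛 → Generators 𝔄 𝓛₀ (asℚ (S (initialProfiles 𝓛 𝓕)))
  generator 𝓛 = initialProfiles 𝓛 𝓕 , μ-independent 𝓛 𝓛₀ (T (initialProfiles 𝓛 𝓕)) restricted∈ , λ i → refl
    where
    restricted∈ : InMu (restrictFam 𝓛 𝔄) (T (initialProfiles 𝓛 𝓕))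
    restricted∈ = restrict 𝓛 𝓕 , ∈-map⁺ (restrict 𝓛) 𝓕∈𝔄 , λ i → sym (T-profileIndices (restrict 𝓛 𝓕) i)
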